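{- Let $G^1$ be a 1-wconnected 1-graph with infinitely many boundary 1-nodes, and let $^{*}G^1$ be its enlargement with respect to a free ultrafilter $\mathcal F$ on $\mathbb N$, with principal 1-galaxy $\Gamma_0^1$, and suppose $^{*}G^1$ has a hypernode (of rank 0 or 1) not in $\Gamma_0^1$. Then the set of 1-galaxies of $^{*}G^1$ is partially ordered according to closeness to $\Gamma_0^1$: the relation "$\Gamma_a^1=\Gamma_b^1$ or $\Gamma_a^1$ is closer to $\Gamma_0^1$ than is $\Gamma_b^1$" is reflexive, antisymmetric and transitive.
   Context: Let $G^0=\{X^0,B\}$ be a graph with 0-nodes $X^0$ and branches $B$. A 0-tip is an equivalence class of one-ended paths of $G^0$ under eventual identity. Partition the 0-tips into subsets and add to each at most one 0-node (no 0-node added twice); the resulting sets are the 1-nodes, $X^1$, and $G^1=\{X^0,B,X^1\}$. A 0-walk is a finite or infinite alternating sequence of 0-nodes and branches, each branch incident to its neighbouring 0-nodes; a one-ended/endless 0-walk is extended if its tails are eventually one-ended paths, and then traverses their 0-tips. A 0-walk reaches a 1-node $x^1$ if it traverses a 0-tip in $x^1$ or terminates at a 0-node in $x^1$. A two-ended 1-walk is $\langle x_0,W_0^0,x_1^1,\dots,x_{m-1}^1,W_{m-1}^0,x_m\rangle$ ($m\ge1$) with internal terms 1-nodes, each $W_k^0$ a nontrivial 0-walk reaching its two neighbouring nodes, each internal $x_k^1$ reached through a 0-tip by at least one of $W_{k-1}^0,W_k^0$. $G^1$ is 1-wconnected if every two nodes are reached by some 0-walk or 1-walk. 0-sections are subgraphs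 of $G^0$ induced by maximal sets of branches pairwise connected by paths; a boundary 1-node is incident (contains a 0-node of a branch of, or a 0-tip with a representative path in) at least two 0-sections. Lengths: finite 0-walk = number of branch traversals, extended one-ended 0-walk $=\omega$, extended endless $=\omega\cdot2$, two-ended 1-walk = natural sum of its 0-walk lengths. The wdistance $d(x,y)<\omega^2$ is the minimum length of a two-ended walk terminating at $x,y$. Enlargement: 0-hypernodes (1-hypernodes) are classes $[x_n]$ of sequences of 0-nodes (1-nodes) modulo $\langle x_n\rangle\sim\langle y_n\rangle$ iff $\{n:x_n=y_n\}\in\mathcal F$; standard hypernodes have constant representatives; hyperbranches are classes $[\{x_n,y_n\}]$ with $\{n:\{x_n,y_n\}\in B\}\in\mathcal F$. Hypernodes $[x_n],[y_n]$ are 1-limitedly distant if $\{n:d(x_n,y_n)\le\omega\cdot k\}\in\mathcal F$ for some $k\in\mathbb N$; classes are nodal 1-galaxies; a 1-galaxy is a nodal 1-galaxy with all hyperbranches whose both 0-hypernodes lie in it; $\Gamma_0^1$ contains the standard hypernodes. For ordinals $\alpha,\beta<\omega^2$, "$\alpha-\beta\ge\omega\cdot m$" means $\alpha\ge\beta\oplus\omega\cdot m$ with $\oplus$ the natural sum. For 1-galaxies $\Gamma_a^1,\Gamma_b^1$, $\Gamma_a^1$ is closer to $\Gamma_0^1$ than is $\Gamma_b^1$ if there are $\mathbf y=[y_n]$ in $\Gamma_a^1$, $\mathbf z=[z_n]$ in $\Gamma_b^1$, $\mathbf x=[x_n]$ in $\Gamma_0^1$ with $\{n:d(z_n,x_n)-d(y_n,x_n)\ge\omega\cdot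 m\}\in\mathcal F$ for every $m\in\mathbb N$. -}

module Defs where

open import Data.Nat using (ℕ; zero; suc; _+_; _≤_; _<_; pred)
open import Data.Fin using (Fin; inject₁; fromℕ) renaming (zero to fzero; suc to fsuc)
open import Data.Integer as ℤ using (ℤ; +_; -_)
open import Data.Product using (Σ; _×_; _,_; proj₁; proj₂)
open import Data.Sum using (_⊎_; inj₁; inj₂)
open import Data.Empty using (⊥)
open import Data.Unit using (⊤)
open import Relation.Nullary using (¬_)
open import Relation.Binary.PropositionalEquality using (_≡_)
open import Relation.Binary.Structures using (IsPartialOrder)

-- Ordinals below ω² :  ord a b  stands for  ω·a + b

record Ord2 : Set where
  constructor ord
  field
    lim : ℕ
    fin : ℕ

_≤ᵒ_ : Ord2 → Ord2 → Set
ord a b ≤ᵒ ord c d = a < c ⊎ (a ≡ c × b ≤ d)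

-- natural (Hessenberg) sum
_⊕_ : Ord2 → Ord2 → Ord2
ord a b ⊕ ord c d = ord (a + c) (b + d)

ω* : ℕ → Ord2
ω* k = ord k 0

-- 0-graphs G⁰ = {X⁰, B}.  A branch is an (unordered) pair {u,v} of
-- distinct 0-nodes; B is given as a symmetric irreflexive relation.

record Graph0 : Set₁ where
  field
    X0         : Set
    Adj        : X0 → X0 → Set
    Adj-sym    : ∀ {u v} → Adj u v → Adj v u
    Adj-irrefl : ∀ {u} → ¬ Adj u u

module Zero (G : Graph0) where
  open Graph0 G

  IsRay : (ℕ → X0) → Set
  IsRay p = ∀ i → Adj (p i) (p (suc i))

  IsOneEndedPath : (ℕ → X0) → Set
  IsOneEndedPath p = IsRay p × (∀ i j → p i ≡ p j → i ≡ j)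

  OneEndedPath : Set
  OneEndedPath = Σ (ℕ → X0) IsOneEndedPath

  -- eventual identity of one-ended paths (0-tips are its classes)
  EventuallyIdentical : OneEndedPath → OneEndedPath → Set
  EventuallyIdentical (p , _) (q , _) =
    Σ ℕ λ m → Σ ℕ λ k → ∀ i → p (m + i) ≡ q (k + i)

  tail : (ℕ → X0) → ℕ → ℕ → X0
  tail p m i = p (m + i)

  Extended : (ℕ → X0) → Set
  Extended p = Σ ℕ λ m → IsOneEndedPath (tail p m)

  FinWalk : X0 → X0 → ℕ → Set
  FinWalk u v n =
    Σ (Fin (suc n) → X0) λ w →
      (∀ (i : Fin n) → Adj (w (inject₁ i)) (w (fsuc i)))
      × w fzero ≡ u × w (fromℕ n) ≡ v

  FinPath : X0 → X0 → Set
  FinPath u v =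
    Σ ℕ λ n → Σ (Fin (suc n) → X0) λ w →
      (∀ (i : Fin n) → Adj (w (inject₁ i)) (w (fsuc i)))
      × (∀ i j → w i ≡ w j → i ≡ j)
      × w fzero ≡ u × w (fromℕ n) ≡ v

  Branch : Set
  Branch = Σ X0 λ u → Σ X0 λ v → Adj u v

  -- two branches are connected by a path (from a node of one to a node
  -- of the other); 0-sections are the classes of this relation
  SameSection : Branch → Branch → Set
  SameSection (u , v , _) (u' , v' , _) =
    FinPath u u' ⊎ FinPath u v' ⊎ FinPath v u' ⊎ FinPath v v'

-- the 1-graph structure: 1-nodes X¹ form a partition of the 0-tips
-- (nonempty blocks, closed under eventual identity), each 1-node having
-- at most one added 0-node, no 0-node added twice.

record OneStructure (G : Graph0) : Set₁ where
  open Graph0 G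
  open Zero G
  field
    X1          : Set
    tipIn       : OneEndedPath → X1 → Set
    tipIn-resp  : ∀ {p q x} → EventuallyIdentical p q → tipIn p x → tipIn q x
    tipIn-total : ∀ p → Σ X1 λ x → tipIn p x
    tipIn-func  : ∀ {p x y} → tipIn p x → tipIn p y → x ≡ y
    block-nonempty : ∀ x → Σ OneEndedPath λ p → tipIn p x
    nodeIn      : X0 → X1 → Set
    nodeIn-atMostOne : ∀ {u v x} → nodeIn u x → nodeIn v x → u ≡ v
    nodeIn-once : ∀ {u x y} → nodeIn u x → nodeIn u y → x ≡ y

module One (G : Graph0) (S : OneStructure G) where
  open Graph0 G
  open Zero G
  open OneStructure S

  Node : Set
  Node = X0 ⊎ X1

  Is1Node : Node → Set
  Is1Node (inj₁ _) = ⊥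
  Is1Node (inj₂ _) = ⊤

  -- an end of a 0-walk: a terminal 0-node, or a traversed 0-tip given by
  -- a one-way infinite walk (oriented away from the walk) that is
  -- eventually a one-ended path
  data End : Set where
    nodeE : X0 → End
    tipE  : (ℕ → X0) → End

  ReachesByTip : End → Node → Set
  ReachesByTip (nodeE _) _        = ⊥
  ReachesByTip (tipE w) (inj₁ _)  = ⊥
  ReachesByTip (tipE w) (inj₂ x)  =
    Σ ℕ λ m → Σ (IsOneEndedPath (tail w m)) λ P → tipIn (tail w m , P) x

  Reaches : End → Node → Set
  Reaches (nodeE v) (inj₁ u) = v ≡ u
  Reaches (nodeE v) (inj₂ x) = nodeIn v x
  Reaches (tipE w)  n        = ReachesByTip (tipE w) n

  data Walk0 : Set where
    fin     : (n : ℕ) (w : Fin (suc n) → X0) →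
              (∀ (i : Fin n) → Adj (w (inject₁ i)) (w (fsuc i))) → Walk0
    ray     : (w : ℕ → X0) → IsRay w → Extended w → Walk0
    rayRev  : (w : ℕ → X0) → IsRay w → Extended w → Walk0
    endless : (w : ℤ → X0) → (∀ i → Adj (w i) (w (i ℤ.+ + 1))) →
              Extended (λ i → w (+ i)) → Extended (λ i → w (- (+ i))) → Walk0

  startE : Walk0 → End
  startE (fin n w _)         = nodeE (w fzero)
  startE (ray w _ _)         = nodeE (w 0)
  startE (rayRev w _ _)      = tipE w
  startE (endless w _ _ _)   = tipE (λ i → w (- (+ i)))

  finishE : Walk0 → End
  finishE (fin n w _)        = nodeE (w (fromℕ n))
  finishE (ray w _ _)        = tipE w
  finishE (rayRev w _ _)     = nodeE (w 0)
  finishE (endless w _ _ _)  = tipE (λ i → w (+ i))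

  Nontrivial : Walk0 → Set
  Nontrivial (fin n _ _) = 1 ≤ n
  Nontrivial _           = ⊤

  len0 : Walk0 → Ord2
  len0 (fin n _ _)       = ord 0 n
  len0 (ray _ _ _)       = ω* 1
  len0 (rayRev _ _ _)    = ω* 1
  len0 (endless _ _ _ _) = ω* 2

  sumOrd : (ℕ → Ord2) → ℕ → Ord2
  sumOrd f zero    = ord 0 0
  sumOrd f (suc m) = sumOrd f m ⊕ f m

  record Walk1 (x y : Node) : Set where
    field
      m        : ℕ
      m≥1      : 1 ≤ m
      node     : ℕ → Node
      walk     : ℕ → Walk0
      first    : node 0 ≡ x
      last     : node m ≡ y
      internal : ∀ k → 0 < k → k < m → Is1Node (node k)
      nontriv  : ∀ k → k < m → Nontrivial (walk k)
      reachS   : ∀ k → k < m → Reaches (startE (walk k)) (node k)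
      reachF   : ∀ k → k < m → Reaches (finishE (walk k)) (node (suc k))
      viaTip   : ∀ k → 0 < k → k < m →
                 ReachesByTip (finishE (walk (pred k))) (node k)
                 ⊎ ReachesByTip (startE (walk k)) (node k)

  len1 : ∀ {x y} → Walk1 x y → Ord2
  len1 W = sumOrd (λ k → len0 (Walk1.walk W k)) (Walk1.m W)

  data TwoEndedWalk : Node → Node → Ord2 → Set where
    walk0 : ∀ {u v n} → FinWalk u v n → TwoEndedWalk (inj₁ u) (inj₁ v) (ord 0 n)
    walk1 : ∀ {x y} (W : Walk1 x y) → TwoEndedWalk x y (len1 W)

  Dist : Node → Node → Ord2 → Set
  Dist x y α = TwoEndedWalk x y α × (∀ β → TwoEndedWalk x y β → α ≤ᵒ β)

  Wconnected : Set
  Wconnected = ∀ x y → Σ Ord2 λ α → TwoEndedWalk x y α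

  IncidentSection : X1 → Branch → Set
  IncidentSection x b =
    (Σ Branch λ b' → SameSection b b' ×
        (nodeIn (proj₁ b') x ⊎ nodeIn (proj₁ (proj₂ b')) x))
    ⊎ (Σ OneEndedPath λ p → tipIn p x ×
        (∀ i → SameSection b (proj₁ p i , proj₁ p (suc i) , proj₁ (proj₂ p) i)))

  Boundary : X1 → Set
  Boundary x = Σ Branch λ b → Σ Branch λ b' →
    ¬ SameSection b b' × IncidentSection x b × IncidentSection x b'

  InfinitelyManyBoundary : Set
  InfinitelyManyBoundary =
    Σ (ℕ → X1) λ f → (∀ i j → f i ≡ f j → i ≡ j) × (∀ i → Boundary (f i))

-- free ultrafilters on ℕ (subsets of ℕ as predicates)

record FreeUltrafilter : Set₁ where
  field
    _∈F    : (ℕ → Set) → Set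
    upward  : ∀ {P Q : ℕ → Set} → (∀ n → P n → Q n) → P ∈F → Q ∈F
    inter   : ∀ {P Q : ℕ → Set} → P ∈F → Q ∈F → (λ n → P n × Q n) ∈F
    proper  : ¬ ((λ _ → ⊥) ∈F)
    ultra   : ∀ (P : ℕ → Set) → P ∈F ⊎ (λ n → ¬ P n) ∈F
    free    : ∀ k → (λ n → k ≤ n) ∈F

module Enlargement (G : Graph0) (S : OneStructure G) (𝓕 : FreeUltrafilter) where
  open Graph0 G
  open OneStructure S
  open One G S
  open FreeUltrafilter 𝓕

  -- a hypernode (of rank 0 or 1) given by a representative sequence
  HyperNode : Set
  HyperNode = (ℕ → X0) ⊎ (ℕ → X1)

  at : HyperNode → ℕ → Node
  at (inj₁ s) n = inj₁ (s n)
  at (inj₂ s) n = inj₂ (s n)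

  -- 1-limitedly distant (same nodal 1-galaxy)
  LimDist : HyperNode → HyperNode → Set
  LimDist a b = Σ ℕ λ k →
    (λ n → Σ Ord2 λ α → Dist (at a n) (at b n) α × α ≤ᵒ ω* k) ∈F

  Standard : HyperNode → Set
  Standard (inj₁ s) = Σ X0 λ u → ∀ n → s n ≡ u
  Standard (inj₂ s) = Σ X1 λ x → ∀ n → s n ≡ x

  InΓ₀ : HyperNode → Set
  InΓ₀ a = Σ HyperNode λ s → Standard s × LimDist a s

  Closer : HyperNode → HyperNode → Set
  Closer a b = Σ HyperNode λ y → Σ HyperNode λ z → Σ HyperNode λ x →
    LimDist y a × LimDist z b × InΓ₀ x ×
    (∀ m → (λ n → Σ Ord2 λ α → Σ Ord2 λ β →
       Dist (at z n) (at x n) α × Dist (at y n) (at x n) β ×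
       (β ⊕ ω* m) ≤ᵒ α) ∈F)

  CloserOrEq : HyperNode → HyperNode → Set
  CloserOrEq a b = LimDist a b ⊎ Closer a b

module Submission where

-- Only the ω-coefficients of wdistances matter. Two-ended walks can be reversed, and
-- concatenated with the ω-coefficients of their lengths adding up (two 0-walks meeting
-- at a 0-node are merged into one), so "joined by a walk shorter than ω·K on an
-- 𝓕-large set, for some K" is an equivalence relation; it is 1-limited distance,
-- because a shortest walk exists up to double negation and the ultrafilter decides
-- every set. Let D(y) be the hypernatural ω-coefficient of d(yₙ, xₙ) for x in Γ₀¹.
-- Moving y within its 1-galaxy, or x within Γ₀¹, changes D by a bounded amount,
-- whereas a closer 1-galaxy has D smaller by an unbounded amount. So closeness is a
-- transitive relation on 1-galaxies that never relates a 1-galaxy to itself.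

open import Defs
open import Data.Nat using (ℕ; zero; suc; _+_; _∸_; _≤_; _<_; pred; z≤n; s≤s)
open import Data.Nat.Induction using (<-rec)
import Data.Nat.Properties as ℕ
open import Algebra.Properties.CommutativeSemigroup ℕ.+-commutativeSemigroup
  using (xy∙z≈x∙zy; xy∙z≈xz∙y)
open import Data.Nat.Solver using (module +-*-Solver)
open import Data.Fin using (Fin; inject₁; fromℕ; toℕ) renaming (zero to fzero; suc to fsuc)
open import Data.Fin.Properties using (toℕ-inject₁; toℕ-fromℕ; toℕ<n)
open import Data.Integer as ℤ using (ℤ; +_; -_; -[1+_])
import Data.Integer.Properties as ℤ
open import Data.Product using (Σ; _×_; _,_; proj₁; proj₂)
open import Data.Sum as Sum using (_⊎_; inj₁; inj₂)
open import Data.Empty using (⊥; ⊥-elim)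
open import Data.Unit using (⊤; tt)
open import Function using (id; _∘_)
open import Relation.Nullary using (¬_; yes; no)
open import Relation.Binary.Definitions using (tri<; tri≈; tri>)
open import Relation.Binary.PropositionalEquality
open import Relation.Binary.Structures using (IsEquivalence; IsPartialOrder)

≤ᵒ⇒lim≤ : ∀ {α β} → α ≤ᵒ β → Ord2.lim α ≤ Ord2.lim β
≤ᵒ⇒lim≤ {ord a b} {ord c d} (inj₁ a<c)        = ℕ.<⇒≤ a<c
≤ᵒ⇒lim≤ {ord a b} {ord c d} (inj₂ (refl , _)) = ℕ.≤-refl

-- Constructively only the double negation survives: ≤ᵒ is well founded
-- but a least element cannot be computed.
least-¬¬ : (T : Ord2 → Set) {γ : Ord2} → T γ →
           ¬ ¬ (Σ Ord2 λ α → T α × (∀ β → T β → α ≤ᵒ β))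
least-¬¬ T {ord a₀ b₀} t₀ noLeast = noneAt a₀ b₀ t₀
  where
  noneAt : ∀ a b → ¬ T (ord a b)
  noneAt = <-rec _ λ a noneBelowA → <-rec _ λ b noneBelowB t →
    noLeast (ord a b , t , λ { (ord c d) t′ → isLeast noneBelowA noneBelowB t′ })
    where
    isLeast : ∀ {a b c d} →
              (∀ {a′} → a′ < a → ∀ b′ → ¬ T (ord a′ b′)) →
              (∀ {b′} → b′ < b → ¬ T (ord a b′)) →
              T (ord c d) → ord a b ≤ᵒ ord c d
    isLeast {a} {b} {c} {d} noneBelowA noneBelowB t′ with ℕ.<-cmp a c
    ... | tri< a<c _ _ = inj₁ a<c
    ... | tri> _ _ c<a = ⊥-elim (noneBelowA c<a d t′)
    ... | tri≈ _ refl _ with b ℕ.≤? d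
    ...   | yes b≤d = inj₂ (refl , b≤d)
    ...   | no b≰d  = ⊥-elim (noneBelowB (ℕ.≰⇒> b≰d) t′)

gap-transfer : ∀ {b M K₁ K₂ a b′ a′ a″} → b + (suc M + (K₁ + (K₂ + K₂))) ≤ a →
               a ≤ (K₁ + b′) + K₂ → b′ + 0 ≤ a′ → a′ ≤ a″ + K₂ → b + M < a″
gap-transfer {b} {M} {K₁} {K₂} {a} {b′} {a′} {a″} b+M+C≤a a≤K₁+b′+K₂ b′≤a′ a′≤a″+K₂ =
  ℕ.+-cancelʳ-≤ C (suc (b + M)) a″ (begin
    suc (b + M) + C         ≡⟨ cong suc (ℕ.+-assoc b M C) ⟩
    suc (b + (M + C))       ≡⟨ sym (ℕ.+-suc b (M + C)) ⟩
    b + (suc M + C)         ≤⟨ b+M+C≤a ⟩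
    a                       ≤⟨ a≤K₁+b′+K₂ ⟩
    (K₁ + b′) + K₂          ≤⟨ ℕ.+-monoˡ-≤ K₂ (ℕ.+-monoʳ-≤ K₁ b′≤a″+K₂) ⟩
    (K₁ + (a″ + K₂)) + K₂   ≡⟨ +-*-Solver.solve 3 (λ k₁ k₂ c → (k₁ :+ (c :+ k₂)) :+ k₂ := c :+ (k₁ :+ (k₂ :+ k₂)))
                                 refl K₁ K₂ a″ ⟩
    a″ + C                  ∎)
  where
  open ℕ.≤-Reasoning
  open +-*-Solver using (_:+_; _:=_)
  C : ℕ
  C = K₁ + (K₂ + K₂)
  b′≤a″+K₂ : b′ ≤ a″ + K₂
  b′≤a″+K₂ = ℕ.≤-trans (ℕ.≤-trans (ℕ.≤-reflexive (sym (ℕ.+-identityʳ b′))) b′≤a′) a′≤a″+K₂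

module UltrafilterProperties (𝓕 : FreeUltrafilter) where
  open FreeUltrafilter 𝓕

  ∀⇒∈F : ∀ {P : ℕ → Set} → (∀ n → P n) → P ∈F
  ∀⇒∈F p = upward (λ n _ → p n) (free 0)

  ∈F-¬¬-stable : ∀ {Q P : ℕ → Set} → Q ∈F → (∀ n → Q n → ¬ ¬ P n) → P ∈F
  ∈F-¬¬-stable {Q} {P} q ¬¬p with ultra P
  ... | inj₁ p  = p
  ... | inj₂ ¬p = ⊥-elim (proper (upward (λ n (qₙ , ¬pₙ) → ¬¬p n qₙ ¬pₙ) (inter q ¬p)))

  ∈F-⊥ : ∀ {Q : ℕ → Set} → Q ∈F → ¬ (∀ n → ¬ Q n)
  ∈F-⊥ q ¬q = proper (upward ¬q q)

module Walks (G : Graph0) (S : OneStructure G) where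
  open Graph0 G
  open Zero G
  open OneStructure S
  open One G S

  IsOneEndedPath-cong : ∀ {f g : ℕ → X0} → (∀ i → f i ≡ g i) →
                        IsOneEndedPath f → IsOneEndedPath g
  IsOneEndedPath-cong f≗g (isRay , injective) =
    (λ i → subst₂ Adj (f≗g i) (f≗g (suc i)) (isRay i)) ,
    (λ i j eq → injective i j (trans (f≗g i) (trans eq (sym (f≗g j)))))

  tail-drop : ∀ {f g : ℕ → X0} a → (∀ i → f (a + i) ≡ g i) →
              ∀ m i → tail g m i ≡ tail f (a + m) i
  tail-drop {f} a f≗g m i = sym (trans (cong f (ℕ.+-assoc a m i)) (f≗g (m + i)))

  Extended-drop : ∀ {f g : ℕ → X0} a → (∀ i → f (a + i) ≡ g i) → Extended g → Extended f
  Extended-drop {f} a f≗g (m , P) = a + m , IsOneEndedPath-cong (tail-drop {f} a f≗g m) P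

  ReachesByTip-drop : ∀ {f g : ℕ → X0} a → (∀ i → f (a + i) ≡ g i) →
                      ∀ x → ReachesByTip (tipE g) x → ReachesByTip (tipE f) x
  ReachesByTip-drop {f} {g} a f≗g (inj₂ x) (m , P , t) =
    a + m , IsOneEndedPath-cong e P , tipIn-resp (0 , 0 , e) t
    where
    e : ∀ i → tail g m i ≡ tail f (a + m) i
    e = tail-drop {f} a f≗g m

  _⊑ᴱ_ : End → End → Set
  e ⊑ᴱ e′ = (∀ x → Reaches e x → Reaches e′ x) × (∀ x → ReachesByTip e x → ReachesByTip e′ x)

  ⊑ᴱ-refl : ∀ {e} → e ⊑ᴱ e
  ⊑ᴱ-refl = (λ _ r → r) , (λ _ r → r)

  ⊑ᴱ-node : ∀ {v v′} → v ≡ v′ → nodeE v ⊑ᴱ nodeE v′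
  ⊑ᴱ-node {v} refl = ⊑ᴱ-refl {nodeE v}

  ⊑ᴱ-drop : ∀ {f g : ℕ → X0} a → (∀ i → f (a + i) ≡ g i) → tipE g ⊑ᴱ tipE f
  ⊑ᴱ-drop {f} a f≗g = ReachesByTip-drop {f} a f≗g , ReachesByTip-drop {f} a f≗g

  ReachesByTip⇒Is1Node : ∀ e x → ReachesByTip e x → Is1Node x
  ReachesByTip⇒Is1Node (nodeE _) _        ()
  ReachesByTip⇒Is1Node (tipE _)  (inj₁ _) ()
  ReachesByTip⇒Is1Node (tipE _)  (inj₂ _) _ = tt

  Reaches-nodeE-unique : ∀ {v v′} x → Reaches (nodeE v) x → Reaches (nodeE v′) x → v ≡ v′
  Reaches-nodeE-unique (inj₁ u) v≡u v′≡u = trans v≡u (sym v′≡u)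
  Reaches-nodeE-unique (inj₂ x) v∈x v′∈x = nodeIn-atMostOne v∈x v′∈x

  -- Finite walks as sequences indexed by ℕ

  IsFinWalk : ℕ → (ℕ → X0) → Set
  IsFinWalk n f = ∀ i → i < n → Adj (f i) (f (suc i))

  clamp : (n : ℕ) → ℕ → Fin (suc n)
  clamp zero    _       = fzero
  clamp (suc n) zero    = fzero
  clamp (suc n) (suc i) = fsuc (clamp n i)

  clamp-zero : ∀ n → clamp n 0 ≡ fzero
  clamp-zero zero    = refl
  clamp-zero (suc n) = refl

  clamp-self : ∀ n → clamp n n ≡ fromℕ n
  clamp-self zero    = refl
  clamp-self (suc n) = cong fsuc (clamp-self n)

  clamp-isFinWalk : ∀ n (w : Fin (suc n) → X0) →
                    (∀ (j : Fin n) → Adj (w (inject₁ j)) (w (fsuc j))) →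
                    IsFinWalk n (w ∘ clamp n)
  clamp-isFinWalk (suc n) w adj zero    _ =
    subst (λ j → Adj (w fzero) (w (fsuc j))) (sym (clamp-zero n)) (adj fzero)
  clamp-isFinWalk (suc n) w adj (suc i) (s≤s i<n) =
    clamp-isFinWalk n (w ∘ fsuc) (adj ∘ fsuc) i i<n

  finWalk : (n : ℕ) (f : ℕ → X0) → IsFinWalk n f → Walk0
  finWalk n f adj = fin n (f ∘ toℕ) λ j →
    subst (λ t → Adj (f t) (f (suc (toℕ j)))) (sym (toℕ-inject₁ j)) (adj (toℕ j) (toℕ<n j))

  reverse-isFinWalk : ∀ n f → IsFinWalk n f → IsFinWalk n (λ i → f (n ∸ i))
  reverse-isFinWalk n f adj i i<n =
    subst (λ t → Adj (f t) (f (n ∸ suc i))) (sym (ℕ.+-∸-assoc 1 i<n))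
      (Adj-sym (adj (n ∸ suc i) (ℕ.∸-monoʳ-< (s≤s z≤n) i<n)))

  -- glue n f g follows f for n steps and then g; it is a walk when f n ≡ g 0.
  glue : ℕ → (ℕ → X0) → (ℕ → X0) → ℕ → X0
  glue zero    f g i       = g i
  glue (suc n) f g zero    = f zero
  glue (suc n) f g (suc i) = glue n (f ∘ suc) g i

  glue-≤ : ∀ n f g {i} → i ≤ n → f n ≡ g 0 → glue n f g i ≡ f i
  glue-≤ zero    f g z≤n       fn≡g0 = sym fn≡g0
  glue-≤ (suc n) f g z≤n       fn≡g0 = refl
  glue-≤ (suc n) f g (s≤s i≤n) fn≡g0 = glue-≤ n (f ∘ suc) g i≤n fn≡g0

  glue-+ : ∀ n f g i → glue n f g (n + i) ≡ g i
  glue-+ zero    f g i = refl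
  glue-+ (suc n) f g i = glue-+ n (f ∘ suc) g i

  glue-adjacent : ∀ n f g → IsFinWalk n f → f n ≡ g 0 →
                  (P : ℕ → Set) → (∀ i → P i → Adj (g i) (g (suc i))) →
                  ∀ i → i < n ⊎ P (i ∸ n) → Adj (glue n f g i) (glue n f g (suc i))
  glue-adjacent zero    f g adjf fn≡g0 P adjg i       (inj₂ p)         = adjg i p
  glue-adjacent (suc n) f g adjf fn≡g0 P adjg zero    _                =
    subst (Adj (f 0)) (sym (glue-≤ n (f ∘ suc) g z≤n fn≡g0)) (adjf 0 (s≤s z≤n))
  glue-adjacent (suc n) f g adjf fn≡g0 P adjg (suc i) i<n⊎p =
    glue-adjacent n (f ∘ suc) g (λ j j<n → adjf (suc j) (s≤s j<n)) fn≡g0 P adjg i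
      (Sum.map ℕ.≤-pred id i<n⊎p)

  <-+-split : ∀ n k i → i < n + k → i < n ⊎ i ∸ n < k
  <-+-split zero    k i       i<k           = inj₂ i<k
  <-+-split (suc n) k zero    _             = inj₁ (s≤s z≤n)
  <-+-split (suc n) k (suc i) (s≤s i<n+k) = Sum.map s≤s id (<-+-split n k i i<n+k)

  glue-isFinWalk : ∀ n k f g → IsFinWalk n f → f n ≡ g 0 → IsFinWalk k g →
                   IsFinWalk (n + k) (glue n f g)
  glue-isFinWalk n k f g adjf fn≡g0 adjg i i<n+k =
    glue-adjacent n f g adjf fn≡g0 (_< k) adjg i (<-+-split n k i i<n+k)

  glue-isRay : ∀ n f g → IsFinWalk n f → f n ≡ g 0 → IsRay g → IsRay (glue n f g)
  glue-isRay n f g adjf fn≡g0 adjg i =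
    glue-adjacent n f g adjf fn≡g0 (λ _ → ⊤) (λ j _ → adjg j) i (inj₂ tt)

  -- Reversing and merging 0-walks

  ωlen : Walk0 → ℕ
  ωlen W = Ord2.lim (len0 W)

  -[i+1]+1≡-i : ∀ i → (- (i ℤ.+ + 1)) ℤ.+ + 1 ≡ - i
  -[i+1]+1≡-i i = begin
    (- (i ℤ.+ + 1)) ℤ.+ + 1      ≡⟨ cong (ℤ._+ + 1) (ℤ.neg-distrib-+ i (+ 1)) ⟩
    ((- i) ℤ.+ -[1+ 0 ]) ℤ.+ + 1 ≡⟨ ℤ.+-assoc (- i) -[1+ 0 ] (+ 1) ⟩
    (- i) ℤ.+ + 0                ≡⟨ ℤ.+-identityʳ (- i) ⟩
    - i                          ∎
    where open ≡-Reasoning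

  record Reversal (W : Walk0) : Set where
    field
      reversed   : Walk0
      nontrivial : Nontrivial W → Nontrivial reversed
      start⊒     : finishE W ⊑ᴱ startE reversed
      finish⊒    : startE W ⊑ᴱ finishE reversed
      ωlen-≡     : ωlen reversed ≡ ωlen W

  reverse0 : (W : Walk0) → Reversal W
  reverse0 (fin n w adj) = record
    { reversed   = finWalk n (λ i → f (n ∸ i)) (reverse-isFinWalk n f (clamp-isFinWalk n w adj))
    ; nontrivial = id
    ; start⊒     = ⊑ᴱ-node (cong w (sym (clamp-self n)))
    ; finish⊒    = ⊑ᴱ-node (begin
        w fzero               ≡⟨ cong w (sym (clamp-zero n)) ⟩
        f 0                   ≡⟨ cong f (sym (ℕ.n∸n≡0 n)) ⟩
        f (n ∸ n)             ≡⟨ cong (λ j → f (n ∸ j)) (sym (toℕ-fromℕ n)) ⟩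
        f (n ∸ toℕ (fromℕ n)) ∎)
    ; ωlen-≡     = refl
    }
    where
    open ≡-Reasoning
    f : ℕ → X0
    f = w ∘ clamp n
  reverse0 (ray w isRay ext) =
    record { reversed = rayRev w isRay ext ; nontrivial = id
           ; start⊒ = ⊑ᴱ-refl {tipE w} ; finish⊒ = ⊑ᴱ-refl {nodeE (w 0)} ; ωlen-≡ = refl }
  reverse0 (rayRev w isRay ext) =
    record { reversed = ray w isRay ext ; nontrivial = id
           ; start⊒ = ⊑ᴱ-refl {nodeE (w 0)} ; finish⊒ = ⊑ᴱ-refl {tipE w} ; ωlen-≡ = refl }
  reverse0 (endless w adj ext⁺ ext⁻) = record
    { reversed   = endless (w ∘ -_) adj⁻ ext⁻ (Extended-drop 0 w--≗w ext⁺)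
    ; nontrivial = id
    ; start⊒     = ⊑ᴱ-drop 0 w--≗w
    ; finish⊒    = ⊑ᴱ-refl
    ; ωlen-≡     = refl
    }
    where
    w--≗w : ∀ i → w (- (- (+ i))) ≡ w (+ i)
    w--≗w i = cong w (ℤ.neg-involutive (+ i))
    adj⁻ : ∀ i → Adj (w (- i)) (w (- (i ℤ.+ + 1)))
    adj⁻ i = Adj-sym (subst (Adj (w (- (i ℤ.+ + 1))) ∘ w) (-[i+1]+1≡-i i) (adj (- (i ℤ.+ + 1))))

  record Merge (W V : Walk0) : Set where
    field
      merged     : Walk0
      nontrivial : Nontrivial merged
      start⊒     : startE W ⊑ᴱ startE merged
      finish⊒    : finishE V ⊑ᴱ finishE merged
      ωlen-≤     : ωlen merged ≤ ωlen W + ωlen V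

  nodeE-injective : ∀ {u v} → nodeE u ≡ nodeE v → u ≡ v
  nodeE-injective refl = refl

  -- the endless walk running backwards along w and then forwards along u
  joinRays : (ℕ → X0) → (ℕ → X0) → ℤ → X0
  joinRays w u (+ i)    = u i
  joinRays w u -[1+ i ] = w (suc i)

  merge : (W V : Walk0) {v : X0} → Nontrivial W →
          finishE W ≡ nodeE v → startE V ≡ nodeE v → Merge W V
  merge (ray _ _ _)        V                  _ ()    _
  merge (endless _ _ _ _)  V                  _ ()    _
  merge (fin _ _ _)        (rayRev _ _ _)     _ _     ()
  merge (fin _ _ _)        (endless _ _ _ _)  _ _     ()
  merge (rayRev _ _ _)     (rayRev _ _ _)     _ _     ()
  merge (rayRev _ _ _)     (endless _ _ _ _)  _ _     ()
  merge (fin n w adjw) (fin k u adju) 1≤n endW startV = record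
    { merged     = finWalk (n + k) (glue n f g) (glue-isFinWalk n k f g adjf fn≡g0 adjg)
    ; nontrivial = ℕ.≤-trans 1≤n (ℕ.m≤m+n n k)
    ; start⊒     = ⊑ᴱ-node (trans (cong w (sym (clamp-zero n))) (sym (glue-≤ n f g z≤n fn≡g0)))
    ; finish⊒    = ⊑ᴱ-node (sym (trans (cong (glue n f g) (toℕ-fromℕ (n + k)))
                                (trans (glue-+ n f g k) (cong u (clamp-self k)))))
    ; ωlen-≤     = z≤n
    }
    where
    f g : ℕ → X0
    f = w ∘ clamp n
    g = u ∘ clamp k
    adjf : IsFinWalk n f
    adjf = clamp-isFinWalk n w adjw
    adjg : IsFinWalk k g
    adjg = clamp-isFinWalk k u adju
    fn≡g0 : f n ≡ g 0
    fn≡g0 = trans (cong w (clamp-self n)) (trans (nodeE-injective endW)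
              (trans (sym (nodeE-injective startV)) (cong u (sym (clamp-zero k)))))
  merge (fin n w adjw) (ray u isRay ext) _ endW startV = record
    { merged     = ray (glue n f u) (glue-isRay n f u adjf fn≡u0 isRay)
                       (Extended-drop {glue n f u} n (glue-+ n f u) ext)
    ; nontrivial = tt
    ; start⊒     = ⊑ᴱ-node (trans (cong w (sym (clamp-zero n))) (sym (glue-≤ n f u z≤n fn≡u0)))
    ; finish⊒    = ⊑ᴱ-drop {glue n f u} n (glue-+ n f u)
    ; ωlen-≤     = ℕ.≤-refl
    }
    where
    f : ℕ → X0
    f = w ∘ clamp n
    adjf : IsFinWalk n f
    adjf = clamp-isFinWalk n w adjw
    fn≡u0 : f n ≡ u 0
    fn≡u0 = trans (cong w (clamp-self n)) (trans (nodeE-injective endW) (sym (nodeE-injective startV)))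
  merge (rayRev w isRay ext) (fin k u adju) _ endW startV = record
    { merged     = rayRev (glue k h w) (glue-isRay k h w adjh hk≡w0 isRay)
                          (Extended-drop {glue k h w} k (glue-+ k h w) ext)
    ; nontrivial = tt
    ; start⊒     = ⊑ᴱ-drop {glue k h w} k (glue-+ k h w)
    ; finish⊒    = ⊑ᴱ-node (sym (trans (glue-≤ k h w z≤n hk≡w0) (cong u (clamp-self k))))
    ; ωlen-≤     = ℕ.≤-refl
    }
    where
    g h : ℕ → X0
    g = u ∘ clamp k
    h i = g (k ∸ i)
    adjh : IsFinWalk k h
    adjh = reverse-isFinWalk k g (clamp-isFinWalk k u adju)
    hk≡w0 : h k ≡ w 0
    hk≡w0 = trans (cong g (ℕ.n∸n≡0 k)) (trans (cong u (clamp-zero k))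
              (trans (nodeE-injective startV) (sym (nodeE-injective endW))))
  merge (rayRev w isRayw extw) (ray u isRayu extu) _ endW startV = record
    { merged     = endless (joinRays w u) adj extu (Extended-drop 0 back≗w extw)
    ; nontrivial = tt
    ; start⊒     = ⊑ᴱ-drop 0 back≗w
    ; finish⊒    = ⊑ᴱ-drop 0 (λ _ → refl)
    ; ωlen-≤     = ℕ.≤-refl
    }
    where
    u0≡w0 : u 0 ≡ w 0
    u0≡w0 = trans (nodeE-injective startV) (sym (nodeE-injective endW))
    back≗w : ∀ i → joinRays w u (- (+ i)) ≡ w i
    back≗w zero    = u0≡w0
    back≗w (suc i) = refl
    adj : ∀ i → Adj (joinRays w u i) (joinRays w u (i ℤ.+ + 1))
    adj (+ i)            = subst (Adj (u i) ∘ u) (ℕ.+-comm 1 i) (isRayu i)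
    adj -[1+ zero ]      = subst (Adj (w 1)) (sym u0≡w0) (Adj-sym (isRayw 0))
    adj -[1+ suc i ]     = Adj-sym (isRayw (suc i))

  -- 1-walks as lists of 0-walks

  Step : Node → Walk0 → Node → Set
  Step x W y = Nontrivial W × Reaches (startE W) x × Reaches (finishE W) y

  -- the internal and viaTip conditions of Walk1 at the node y between W and V
  TipJoint : Walk0 → Node → Walk0 → Set
  TipJoint W y V = Is1Node y × (ReachesByTip (finishE W) y ⊎ ReachesByTip (startE V) y)

  data Chain : Node → Walk0 → Walk0 → Node → Set where
    single : ∀ {x y W} → Step x W y → Chain x W W y
    step   : ∀ {x y z W F L} → Step x W y → TipJoint W y F → Chain y F L z → Chain x W L z

  ωlenᶜ : ∀ {x F L y} → Chain x F L y → ℕ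
  ωlenᶜ (single {W = W} _) = ωlen W
  ωlenᶜ (step {W = W} _ _ c) = ωlen W + ωlenᶜ c

  append : ∀ {x y z F L F′ L′} → Chain x F L y → TipJoint L y F′ → Chain y F′ L′ z → Chain x F L′ z
  append (single s)    j c′ = step s j c′
  append (step s j′ c) j c′ = step s j′ (append c j c′)

  ωlenᶜ-append : ∀ {x y z F L F′ L′} (c : Chain x F L y) (j : TipJoint L y F′) (c′ : Chain y F′ L′ z) →
                 ωlenᶜ (append c j c′) ≡ ωlenᶜ c + ωlenᶜ c′
  ωlenᶜ-append (single _) j c′ = refl
  ωlenᶜ-append (step {W = W} _ _ c) j c′ =
    trans (cong (λ t → ωlen W + t) (ωlenᶜ-append c j c′)) (sym (ℕ.+-assoc (ωlen W) (ωlenᶜ c) (ωlenᶜ c′)))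

  rev : Walk0 → Walk0
  rev W = Reversal.reversed (reverse0 W)

  Step-reverse : ∀ {x W y} → Step x W y → Step y (rev W) x
  Step-reverse {W = W} (nt , rs , rf) = nontrivial nt , proj₁ start⊒ _ rf , proj₁ finish⊒ _ rs
    where open Reversal (reverse0 W)

  TipJoint-reverse : ∀ {W y V} → TipJoint W y V → TipJoint (rev V) y (rev W)
  TipJoint-reverse {W} {y} {V} (1-node , viaTip) =
    1-node , Sum.swap (Sum.map (proj₂ (Reversal.start⊒ (reverse0 W)) y)
                               (proj₂ (Reversal.finish⊒ (reverse0 V)) y) viaTip)

  reverseᶜ : ∀ {x F L y} (c : Chain x F L y) → Σ (Chain y (rev L) (rev F) x) λ c′ → ωlenᶜ c′ ≡ ωlenᶜ c
  reverseᶜ (single {W = W} s) = single (Step-reverse s) , Reversal.ωlen-≡ (reverse0 W)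
  reverseᶜ (step {W = W} s j c) with reverseᶜ c
  ... | c′ , ωlen-c′ = append c′ (TipJoint-reverse j) (single (Step-reverse s)) , (begin
    ωlenᶜ (append c′ _ _)    ≡⟨ ωlenᶜ-append c′ _ _ ⟩
    ωlenᶜ c′ + ωlen (rev W)  ≡⟨ cong₂ _+_ ωlen-c′ (Reversal.ωlen-≡ (reverse0 W)) ⟩
    ωlenᶜ c + ωlen W         ≡⟨ ℕ.+-comm (ωlenᶜ c) (ωlen W) ⟩
    ωlen W + ωlenᶜ c         ∎)
    where open ≡-Reasoning

  Reaches-view : ∀ e y → Reaches e y →
                 ReachesByTip e y ⊎ Σ X0 λ v → e ≡ nodeE v × Reaches (nodeE v) y
  Reaches-view (nodeE v) y r = inj₂ (v , refl , r)
  Reaches-view (tipE w)  y r = inj₁ r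

  TipJoint-or-sharedNode : ∀ W V y → Reaches (finishE W) y → Reaches (startE V) y →
                           TipJoint W y V ⊎ Σ X0 λ v → finishE W ≡ nodeE v × startE V ≡ nodeE v
  TipJoint-or-sharedNode W V y rW rV with Reaches-view _ y rW | Reaches-view _ y rV
  ... | inj₁ t | _      = inj₁ (ReachesByTip⇒Is1Node _ y t , inj₁ t)
  ... | inj₂ _ | inj₁ t = inj₁ (ReachesByTip⇒Is1Node _ y t , inj₂ t)
  ... | inj₂ (v , eW , rv) | inj₂ (v′ , eV , rv′) =
    inj₂ (v , eW , trans eV (cong nodeE (Reaches-nodeE-unique y rv′ rv)))

  first-reaches : ∀ {x F L y} → Chain x F L y → Reaches (startE F) x
  first-reaches (single (_ , rs , _))   = rs
  first-reaches (step (_ , rs , _) _ _) = rs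

  replaceFirst : ∀ {x x′ F L z} (c : Chain x F L z) {M} → Nontrivial M → Reaches (startE M) x′ →
                 finishE F ⊑ᴱ finishE M →
                 Σ Walk0 λ L′ → Σ (Chain x′ M L′ z) λ c′ → ωlenᶜ c′ + ωlen F ≡ ωlen M + ωlenᶜ c
  replaceFirst (single (_ , _ , rf)) {M} nt rs F⊑M =
    M , single (nt , rs , proj₁ F⊑M _ rf) , refl
  replaceFirst (step {F = F} (_ , _ , rf) (1-node , viaTip) c) {M} nt rs F⊑M =
    _ , step (nt , rs , proj₁ F⊑M _ rf) (1-node , Sum.map (proj₂ F⊑M _) id viaTip) c ,
    xy∙z≈x∙zy (ωlen M) (ωlenᶜ c) _

  record Concatenation (x : Node) (F : Walk0) (z : Node) (bound : ℕ) : Set where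
    field
      {first last} : Walk0
      chain        : Chain x first last z
      start⊒       : startE F ⊑ᴱ startE first
      ωlenᶜ-≤      : ωlenᶜ chain ≤ bound

  -- At a junction through a 0-node the two 0-walks are merged into one,
  -- since internal nodes of a 1-walk are 1-nodes.
  concat : ∀ {x y z F L F′ L′} (c : Chain x F L y) (c′ : Chain y F′ L′ z) →
           Concatenation x F z (ωlenᶜ c + ωlenᶜ c′)
  concat {y = y} {F′ = F′} (single {W = W} (nt , rs , rf)) c′
    with TipJoint-or-sharedNode W F′ y rf (first-reaches c′)
  ... | inj₁ j = record { chain = step (nt , rs , rf) j c′ ; start⊒ = ⊑ᴱ-refl ; ωlenᶜ-≤ = ℕ.≤-refl }
  ... | inj₂ (v , eW , eV) with merge W F′ nt eW eV
  ...   | m with replaceFirst c′ (Merge.nontrivial m) (proj₁ (Merge.start⊒ m) _ rs) (Merge.finish⊒ m)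
  ...     | _ , c″ , ωlen-c″ =
    record { chain = c″ ; start⊒ = Merge.start⊒ m ; ωlenᶜ-≤ = ℕ.+-cancelʳ-≤ (ωlen F′) _ _ (begin
      ωlenᶜ c″ + ωlen F′                ≡⟨ ωlen-c″ ⟩
      ωlen (Merge.merged m) + ωlenᶜ c′   ≤⟨ ℕ.+-monoˡ-≤ (ωlenᶜ c′) (Merge.ωlen-≤ m) ⟩
      (ωlen W + ωlen F′) + ωlenᶜ c′      ≡⟨ xy∙z≈xz∙y (ωlen W) (ωlen F′) (ωlenᶜ c′) ⟩
      (ωlen W + ωlenᶜ c′) + ωlen F′      ∎) }
    where
    open ℕ.≤-Reasoning
  concat (step {W = W} s (1-node , viaTip) c) c′ with concat c c′
  ... | r = record
    { chain   = step s (1-node , Sum.map id (proj₂ (Concatenation.start⊒ r) _) viaTip) (Concatenation.chain r)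
    ; start⊒  = ⊑ᴱ-refl
    ; ωlenᶜ-≤ = ℕ.≤-trans (ℕ.+-monoʳ-≤ (ωlen W) (Concatenation.ωlenᶜ-≤ r))
                          (ℕ.≤-reflexive (sym (ℕ.+-assoc (ωlen W) (ωlenᶜ c) (ωlenᶜ c′))))
    }

  length : ∀ {x F L y} → Chain x F L y → ℕ
  length (single _)   = 1
  length (step _ _ c) = suc (length c)

  nodeAt : ∀ {x F L y} → Chain x F L y → ℕ → Node
  nodeAt {x = x} _            zero    = x
  nodeAt {y = y} (single _)   (suc _) = y
  nodeAt         (step _ _ c) (suc k) = nodeAt c k

  walkAt : ∀ {x F L y} → Chain x F L y → ℕ → Walk0
  walkAt {F = F} _            zero    = F
  walkAt {F = F} (single _)   (suc _) = F
  walkAt         (step _ _ c) (suc k) = walkAt c k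

  nodeAt-length : ∀ {x F L y} (c : Chain x F L y) → nodeAt c (length c) ≡ y
  nodeAt-length (single _)   = refl
  nodeAt-length (step _ _ c) = nodeAt-length c

  stepAt : ∀ {x F L y} (c : Chain x F L y) k → k < length c →
           Step (nodeAt c k) (walkAt c k) (nodeAt c (suc k))
  stepAt (single s)   zero    _         = s
  stepAt (single _)   (suc _) (s≤s ())
  stepAt (step s _ _) zero    _         = s
  stepAt (step _ _ c) (suc k) (s≤s k<n) = stepAt c k k<n

  jointAt : ∀ {x F L y} (c : Chain x F L y) k → 0 < k → k < length c →
            TipJoint (walkAt c (pred k)) (nodeAt c k) (walkAt c k)
  jointAt (single _)   (suc _)       _ (s≤s ())
  jointAt (step _ j _) (suc zero)    _ _         = j
  jointAt (step _ _ c) (suc (suc k)) _ (s≤s k<n) = jointAt c (suc k) (s≤s z≤n) k<n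

  lim-sumOrd-suc : ∀ f m → Ord2.lim (sumOrd f (suc m)) ≡ Ord2.lim (f 0) + Ord2.lim (sumOrd (f ∘ suc) m)
  lim-sumOrd-suc f zero    = ℕ.+-comm 0 (Ord2.lim (f 0))
  lim-sumOrd-suc f (suc m) =
    trans (cong (λ t → t + Ord2.lim (f (suc m))) (lim-sumOrd-suc f m))
          (ℕ.+-assoc (Ord2.lim (f 0)) _ (Ord2.lim (f (suc m))))

  toWalk1 : ∀ {x F L y} → Chain x F L y → Walk1 x y
  toWalk1 c = record
    { m        = length c
    ; m≥1      = 1≤length c
    ; node     = nodeAt c
    ; walk     = walkAt c
    ; first    = refl
    ; last     = nodeAt-length c
    ; internal = λ k 0<k k<n → proj₁ (jointAt c k 0<k k<n)
    ; nontriv  = λ k k<n → proj₁ (stepAt c k k<n)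
    ; reachS   = λ k k<n → proj₁ (proj₂ (stepAt c k k<n))
    ; reachF   = λ k k<n → proj₂ (proj₂ (stepAt c k k<n))
    ; viaTip   = λ k 0<k k<n → proj₂ (jointAt c k 0<k k<n)
    }
    where
    1≤length : ∀ {x F L y} (c : Chain x F L y) → 1 ≤ length c
    1≤length (single _)   = s≤s z≤n
    1≤length (step _ _ _) = s≤s z≤n

  lim-len1-toWalk1 : ∀ {x F L y} (c : Chain x F L y) → Ord2.lim (len1 (toWalk1 c)) ≡ ωlenᶜ c
  lim-len1-toWalk1 (single _)                = refl
  lim-len1-toWalk1 (step {W = W} _ _ c) =
    trans (lim-sumOrd-suc (len0 ∘ walkAt (step _ _ c)) (length c))
          (cong (λ t → ωlen W + t) (lim-len1-toWalk1 c))

  chainOf : ∀ {x y} (m : ℕ) → 1 ≤ m → (node : ℕ → Node) (walk : ℕ → Walk0) →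
            node 0 ≡ x → node m ≡ y →
            (∀ k → k < m → Step (node k) (walk k) (node (suc k))) →
            (∀ k → 0 < k → k < m → TipJoint (walk (pred k)) (node k) (walk k)) →
            Σ (Chain x (walk 0) (walk (pred m)) y) λ c → ωlenᶜ c ≡ Ord2.lim (sumOrd (len0 ∘ walk) m)
  chainOf (suc zero) _ node walk refl refl steps _ = single (steps 0 (s≤s z≤n)) , refl
  chainOf {y = y} (suc (suc m)) _ node walk refl last steps joints
    with chainOf {y = y} (suc m) (s≤s z≤n) (node ∘ suc) (walk ∘ suc) refl last
           (λ k k<m → steps (suc k) (s≤s k<m))
           (λ { (suc k) _ k<m → joints (suc (suc k)) (s≤s z≤n) (s≤s k<m) })
  ... | c , ωlen-c =
    step (steps 0 (s≤s z≤n)) (joints 1 (s≤s z≤n) (s≤s (s≤s z≤n))) c ,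
    trans (cong (λ t → ωlen (walk 0) + t) ωlen-c) (sym (lim-sumOrd-suc (len0 ∘ walk) (suc m)))

  fromWalk1 : ∀ {x y} (W : Walk1 x y) →
              Σ Walk0 λ F → Σ Walk0 λ L → Σ (Chain x F L y) λ c → ωlenᶜ c ≡ Ord2.lim (len1 W)
  fromWalk1 W = _ , _ , chainOf m m≥1 node walk first last
    (λ k k<m → nontriv k k<m , reachS k k<m , reachF k k<m)
    (λ k 0<k k<m → internal k 0<k k<m , viaTip k 0<k k<m)
    where open Walk1 W

  -- Walks of length below ω·(K+1)

  WalkWithin : Node → Node → ℕ → Set
  WalkWithin x y K = Σ Ord2 λ β → TwoEndedWalk x y β × Ord2.lim β ≤ K

  WalkWithin-mono : ∀ {x y K L} → K ≤ L → WalkWithin x y K → WalkWithin x y L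
  WalkWithin-mono K≤L (β , w , β≤K) = β , w , ℕ.≤-trans β≤K K≤L

  data WalkView (x y : Node) (K : ℕ) : Set where
    trivial : ∀ u → x ≡ inj₁ u → y ≡ inj₁ u → WalkView x y K
    chain   : ∀ {F L} (c : Chain x F L y) → ωlenᶜ c ≤ K → WalkView x y K

  view : ∀ {x y β} → TwoEndedWalk x y β → WalkView x y (Ord2.lim β)
  view (walk0 {u} {n = zero}  (w , _ , w0≡u , wn≡v)) = trivial u refl (cong inj₁ (trans (sym wn≡v) w0≡u))
  view (walk0 {n = suc n} (w , adj , w0≡u , wn≡v)) = chain (single {W = fin (suc n) w adj} (s≤s z≤n , w0≡u , wn≡v)) z≤n
  view (walk1 W) with fromWalk1 W
  ... | _ , _ , c , ωlen-c = chain c (ℕ.≤-reflexive ωlen-c)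

  chain⇒WalkWithin : ∀ {x F L y K} (c : Chain x F L y) → ωlenᶜ c ≤ K → WalkWithin x y K
  chain⇒WalkWithin c ωlen-c≤K =
    _ , walk1 (toWalk1 c) , ℕ.≤-trans (ℕ.≤-reflexive (lim-len1-toWalk1 c)) ωlen-c≤K

  trivialWalk : ∀ u K → WalkWithin (inj₁ u) (inj₁ u) K
  trivialWalk u K = ord 0 0 , walk0 ((λ _ → u) , (λ ()) , refl , refl) , z≤n

  -- A 1-node is joined to itself by a walk out along one of its 0-tips and back.
  WalkWithin-refl : ∀ x → WalkWithin x x 2
  WalkWithin-refl (inj₁ u) = trivialWalk u 2
  WalkWithin-refl (inj₂ x) with block-nonempty x
  ... | (p , P) , p∈x = chain⇒WalkWithin (single {W = merged} (nontrivial , proj₁ start⊒ _ tip , proj₁ finish⊒ _ tip)) ωlen-≤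
    where
    open Merge (merge (rayRev p (proj₁ P) (0 , P)) (ray p (proj₁ P) (0 , P)) tt refl refl)
    tip : ReachesByTip (tipE p) (inj₂ x)
    tip = 0 , P , p∈x

  WalkWithin-sym : ∀ {x y K} → WalkWithin x y K → WalkWithin y x K
  WalkWithin-sym (β , w , β≤K) with view w
  ... | trivial u refl refl = trivialWalk u _
  ... | chain c c≤β with reverseᶜ c
  ...   | c′ , ωlen-c′ = chain⇒WalkWithin c′ (ℕ.≤-trans (ℕ.≤-reflexive ωlen-c′) (ℕ.≤-trans c≤β β≤K))

  WalkWithin-trans : ∀ {x y z K L} → WalkWithin x y K → WalkWithin y z L → WalkWithin x z (K + L)
  WalkWithin-trans {K = K} {L} (β , w , β≤K) (γ , w′ , γ≤L) with view w | view w′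
  ... | trivial _ refl refl | _                   = γ , w′ , ℕ.≤-trans γ≤L (ℕ.m≤n+m L K)
  ... | chain _ _           | trivial _ refl refl = β , w , ℕ.≤-trans β≤K (ℕ.m≤m+n K L)
  ... | chain c c≤β         | chain c′ c′≤γ       =
    chain⇒WalkWithin (Concatenation.chain cat)
      (ℕ.≤-trans (Concatenation.ωlenᶜ-≤ cat) (ℕ.+-mono-≤ (ℕ.≤-trans c≤β β≤K) (ℕ.≤-trans c′≤γ γ≤L)))
    where
    cat : Concatenation _ _ _ (ωlenᶜ c + ωlenᶜ c′)
    cat = concat c c′

  Dist-≤ : ∀ {x y α K} → Dist x y α → WalkWithin x y K → Ord2.lim α ≤ K
  Dist-≤ (_ , least) (β , w , β≤K) = ℕ.≤-trans (≤ᵒ⇒lim≤ (least β w)) β≤K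

  Dist⇒WalkWithin : ∀ {x y α} → Dist x y α → WalkWithin x y (Ord2.lim α)
  Dist⇒WalkWithin {α = α} (w , _) = α , w , ℕ.≤-refl

  Dist-¬¬ : ∀ {x y K} → WalkWithin x y K → ¬ ¬ (Σ Ord2 λ α → Dist x y α)
  Dist-¬¬ (_ , w , _) = least-¬¬ (TwoEndedWalk _ _) w

module Galaxies (G : Graph0) (S : OneStructure G) (𝓕 : FreeUltrafilter) where
  open One G S
  open Enlargement G S 𝓕
  open FreeUltrafilter 𝓕
  open UltrafilterProperties 𝓕
  open Walks G S

  Near : HyperNode → HyperNode → Set
  Near a b = Σ ℕ λ K → (λ n → WalkWithin (at a n) (at b n) K) ∈F

  LimDist⇒Near : ∀ {a b} → LimDist a b → Near a b
  LimDist⇒Near (k , dist≤ωk) =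
    k , upward (λ n (α , d , α≤ωk) → WalkWithin-mono (≤ᵒ⇒lim≤ α≤ωk) (Dist⇒WalkWithin d)) dist≤ωk

  Near⇒LimDist : ∀ {a b} → Near a b → LimDist a b
  Near⇒LimDist (K , walks) = suc K , ∈F-¬¬-stable walks λ n w noDist →
    Dist-¬¬ w λ (α , d) → noDist (α , d , inj₁ (s≤s (Dist-≤ d w)))

  Near-refl : ∀ a → Near a a
  Near-refl a = 2 , ∀⇒∈F (WalkWithin-refl ∘ at a)

  Near-sym : ∀ {a b} → Near a b → Near b a
  Near-sym (K , walks) = K , upward (λ _ → WalkWithin-sym) walks

  Near-trans : ∀ {a b c} → Near a b → Near b c → Near a c
  Near-trans (K , walks) (L , walks′) =
    K + L , upward (λ _ (w , w′) → WalkWithin-trans w w′) (inter walks walks′)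

  LimDist-isEquivalence : IsEquivalence LimDist
  LimDist-isEquivalence = record
    { refl  = λ {a} → Near⇒LimDist (Near-refl a)
    ; sym   = Near⇒LimDist ∘ Near-sym ∘ LimDist⇒Near
    ; trans = λ l l′ → Near⇒LimDist (Near-trans (LimDist⇒Near l) (LimDist⇒Near l′))
    }

  module ≈ = IsEquivalence LimDist-isEquivalence

  at-standard : ∀ s → Standard s → ∀ n → at s n ≡ at s 0
  at-standard (inj₁ s) (u , s≗u) n = cong inj₁ (trans (s≗u n) (sym (s≗u 0)))
  at-standard (inj₂ s) (x , s≗x) n = cong inj₂ (trans (s≗x n) (sym (s≗x 0)))

  Near-standard : Wconnected → ∀ {s s′} → Standard s → Standard s′ → Near s s′
  Near-standard connected {s} {s′} std std′ with connected (at s 0) (at s′ 0)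
  ... | γ , w = Ord2.lim γ , ∀⇒∈F λ n →
    subst₂ (λ u v → WalkWithin u v (Ord2.lim γ)) (sym (at-standard s std n)) (sym (at-standard s′ std′ n))
      (γ , w , ℕ.≤-refl)

  Near-Γ₀ : Wconnected → ∀ {x x′} → InΓ₀ x → InΓ₀ x′ → Near x x′
  Near-Γ₀ connected (s , std , x~s) (s′ , std′ , x′~s′) =
    Near-trans (LimDist⇒Near x~s) (Near-trans (Near-standard connected std std′) (Near-sym (LimDist⇒Near x′~s′)))

  Closer⇒¬Near : ∀ {a b} → Closer a b → ¬ Near a b
  Closer⇒¬Near (y , z , x , y~a , z~b , _ , gap) a~b
    with Near-trans (LimDist⇒Near z~b) (Near-trans (Near-sym a~b) (Near-sym (LimDist⇒Near y~a)))
  ... | K , z⇝y = ∈F-⊥ (inter (gap (suc K)) z⇝y) λ n ((α , β , dzx , dyx , gapₙ) , wzy) →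
    ℕ.1+n≰n (ℕ.+-cancelˡ-≤ (Ord2.lim β) (suc K) K (begin
      Ord2.lim β + suc K ≤⟨ ≤ᵒ⇒lim≤ {β ⊕ ω* (suc K)} {α} gapₙ ⟩
      Ord2.lim α         ≤⟨ Dist-≤ dzx (WalkWithin-trans wzy (Dist⇒WalkWithin dyx)) ⟩
      K + Ord2.lim β     ≡⟨ ℕ.+-comm K (Ord2.lim β) ⟩
      Ord2.lim β + K     ∎))
    where open ℕ.≤-Reasoning

  Closer-trans : Wconnected → ∀ {a b c} → Closer a b → Closer b c → Closer a c
  Closer-trans connected (y , z , x , y~a , z~b , x∈Γ₀ , gap) (y′ , z′ , x′ , y′~b , z′~c , x′∈Γ₀ , gap′)
    with Near-trans (LimDist⇒Near z~b) (Near-sym (LimDist⇒Near y′~b)) | Near-Γ₀ connected x′∈Γ₀ x∈Γ₀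
  ... | K₁ , z⇝y′ | K₂ , x′⇝x = y , z′ , x , y~a , z′~c , x∈Γ₀ , λ M →
    ∈F-¬¬-stable (inter (gap (suc M + (K₁ + (K₂ + K₂)))) (inter (gap′ 0) (inter z⇝y′ x′⇝x)))
      λ n ((α , β , dzx , dyx , gapₙ) , (α′ , β′ , dz′x′ , dy′x′ , gap′ₙ) , wzy′ , wx′x) noGap →
        Dist-¬¬ (WalkWithin-trans (Dist⇒WalkWithin dz′x′) wx′x) λ (α″ , dz′x) →
          noGap (α″ , β , dz′x , dyx , inj₁ (gap-transfer
            (≤ᵒ⇒lim≤ {β ⊕ ω* _} {α} gapₙ)
            (Dist-≤ dzx (WalkWithin-trans (WalkWithin-trans wzy′ (Dist⇒WalkWithin dy′x′)) wx′x))
            (≤ᵒ⇒lim≤ {β′ ⊕ ω* 0} {α′} gap′ₙ)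
            (Dist-≤ dz′x′ (WalkWithin-trans (Dist⇒WalkWithin dz′x) (WalkWithin-sym wx′x)))))

  Closer-respˡ : ∀ {a a′ b} → LimDist a a′ → Closer a′ b → Closer a b
  Closer-respˡ a~a′ (y , z , x , y~a′ , rest) = y , z , x , ≈.trans y~a′ (≈.sym a~a′) , rest

  Closer-respʳ : ∀ {a b b′} → Closer a b → LimDist b b′ → Closer a b′
  Closer-respʳ (y , z , x , y~a , z~b , rest) b~b′ = y , z , x , y~a , ≈.trans z~b b~b′ , rest

  CloserOrEq-trans : Wconnected → ∀ {a b c} → CloserOrEq a b → CloserOrEq b c → CloserOrEq a c
  CloserOrEq-trans connected (inj₁ a~b) (inj₁ b~c) = inj₁ (≈.trans a~b b~c)
  CloserOrEq-trans connected (inj₁ a~b) (inj₂ b<c) = inj₂ (Closer-respˡ a~b b<c)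
  CloserOrEq-trans connected (inj₂ a<b) (inj₁ b~c) = inj₂ (Closer-respʳ a<b b~c)
  CloserOrEq-trans connected (inj₂ a<b) (inj₂ b<c) = inj₂ (Closer-trans connected a<b b<c)

  CloserOrEq-antisym : Wconnected → ∀ {a b} → CloserOrEq a b → CloserOrEq b a → LimDist a b
  CloserOrEq-antisym connected     (inj₁ a~b) _          = a~b
  CloserOrEq-antisym connected     (inj₂ a<b) (inj₁ b~a) =
    ⊥-elim (Closer⇒¬Near a<b (LimDist⇒Near (≈.sym b~a)))
  CloserOrEq-antisym connected {a} (inj₂ a<b) (inj₂ b<a) =
    ⊥-elim (Closer⇒¬Near (Closer-trans connected a<b b<a) (Near-refl a))

  CloserOrEq-isPartialOrder : Wconnected → IsPartialOrder LimDist CloserOrEq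
  CloserOrEq-isPartialOrder connected = record
    { isPreorder = record
      { isEquivalence = LimDist-isEquivalence
      ; reflexive     = inj₁
      ; trans         = CloserOrEq-trans connected
      }
    ; antisym = CloserOrEq-antisym connected
    }

-- The hypotheses on boundary 1-nodes and on a hypernode outside Γ₀¹ only
-- guarantee that there is more than one 1-galaxy; the order does not need them.
theorem11p3 : (G : Graph0) (S : OneStructure G) (𝓕 : FreeUltrafilter) →
    One.Wconnected G S → One.InfinitelyManyBoundary G S →
    Σ (Enlargement.HyperNode G S 𝓕) (λ h → ¬ Enlargement.InΓ₀ G S 𝓕 h) →
    IsPartialOrder (Enlargement.LimDist G S 𝓕) (Enlargement.CloserOrEq G S 𝓕)
theorem11p3 G S 𝓕 connected _ _ = Galaxies.CloserOrEq-isPartialOrder G S 𝓕 connected
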